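{- Let $n$ be a positive integer and let $c$ be a rainbow-free coloring of $\mathbb{Z}_n$ with respect to Schur triples. Then the color $c(1)$ is dominant for $c$. In particular, every rainbow-free coloring of $\mathbb{Z}_n$ has a dominant color.
   Context: A coloring of $\mathbb{Z}_n$ is a surjective map $c:\mathbb{Z}_n\to\{1,\dots,r\}$. A Schur triple is $(x_1,x_2,x_3)\in\mathbb{Z}_n^3$ with $x_1+x_2\equiv x_3\pmod n$; it is rainbow under $c$ if $c(x_1),c(x_2),c(x_3)$ are pairwise distinct, and $c$ is rainbow-free if no Schur triple is rainbow. Identify $\mathbb{Z}_n$ with $\{0,1,\dots,n-1\}$. A color $R$ is dominant for $c$ if for all $0\le i<j\le n-1$ such that the set $S=\{c(x): i\le x\le j\}$ has exactly two elements, $R\in S$. -}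

module Defs where

open import Data.Nat using (ℕ; suc; _+_; _%_; _<_; _≤_; NonZero)
open import Data.Nat.DivMod using (m%n<n)
open import Data.Fin using (Fin; toℕ; fromℕ<)
open import Data.Product using (Σ; ∃; _×_; _,_)
open import Relation.Binary.PropositionalEquality using (_≡_; _≢_)
open import Data.Sum using (_⊎_)

-- Z_n is represented by Fin n (elements 0,…,n-1); addition mod n.
_⊕_ : {n : ℕ} → .{{NonZero n}} → Fin n → Fin n → Fin n
_⊕_ {n} x y = fromℕ< (m%n<n (toℕ x + toℕ y) n)

one : (n : ℕ) → .{{NonZero n}} → Fin n
one n = fromℕ< (m%n<n 1 n)

-- a coloring with r colours: a surjective map Z_n → Fin r
Surjective : {n r : ℕ} → (Fin n → Fin r) → Set
Surjective {n} {r} c = (k : Fin r) → ∃ λ x → c x ≡ k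

RainbowSchur : {n r : ℕ} → .{{NonZero n}} → (Fin n → Fin r) → Fin n → Fin n → Fin n → Set
RainbowSchur c x₁ x₂ x₃ =
  (x₁ ⊕ x₂ ≡ x₃) × (c x₁ ≢ c x₂) × (c x₁ ≢ c x₃) × (c x₂ ≢ c x₃)

RainbowFree : {n r : ℕ} → .{{NonZero n}} → (Fin n → Fin r) → Set
RainbowFree {n} c = (x₁ x₂ x₃ : Fin n) → RainbowSchur c x₁ x₂ x₃ → Data.Empty.⊥
  where import Data.Empty

OccursIn : {n r : ℕ} → (Fin n → Fin r) → Fin n → Fin n → Fin r → Set
OccursIn {n} c i j k = ∃ λ (x : Fin n) → (toℕ i ≤ toℕ x) × (toℕ x ≤ toℕ j) × (c x ≡ k)

HasExactlyTwo : {n r : ℕ} → (Fin n → Fin r) → Fin n → Fin n → Set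
HasExactlyTwo {n} {r} c i j =
  Σ (Fin r) λ a → Σ (Fin r) λ b →
    (a ≢ b) × OccursIn c i j a × OccursIn c i j b ×
    ((k : Fin r) → OccursIn c i j k → (k ≡ a) ⊎ (k ≡ b))

Dominant : {n r : ℕ} → (Fin n → Fin r) → Fin r → Set
Dominant {n} c R = (i j : Fin n) → toℕ i < toℕ j → HasExactlyTwo c i j → OccursIn c i j R

module Submission where

-- Put R = c(1) and take an interval [i, j] of Z_n (i < j) on
-- which c takes exactly two colours.  Suppose R does not occur on [i, j].
-- For every x with x, x+1 ∈ [i, j], the triple (1, x, x+1) is a Schur
-- triple whose colours are R, c(x), c(x+1); neither of the last two is R,
-- so rainbow-freeness forces c(x) = c(x+1).  A function that agrees on all
-- neighbouring points of an interval is constant there, so c is constant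
-- on [i, j], contradicting the two colours.  Since occurrence of a colour
-- in an interval is decidable, R therefore occurs, i.e. R is dominant.

open import Defs
open import Data.Nat using (ℕ; NonZero; zero; suc; _+_; _∸_; _<_; _≤_; _%_; s≤s; z≤n)
open import Data.Nat.Properties using (≤-trans; <⇒≤; n≤1+n; +-suc; +-identityʳ; m≤m+n; m+[n∸m]≡n; _≤?_)
open import Data.Nat.DivMod using (m<n⇒m%n≡m; m%n<n)
open import Data.Fin using (Fin; toℕ; fromℕ<)
open import Data.Fin.Properties using (toℕ-injective; toℕ-fromℕ<; toℕ<n; any?) renaming (_≟_ to _≟ᶠ_)
open import Data.Product using (_×_; ∃; _,_)
open import Data.Empty using (⊥-elim)
open import Relation.Nullary using (Dec; yes; no)
open import Relation.Nullary.Decidable using (_×-dec_)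
open import Relation.Binary.PropositionalEquality

constant-on-interval : {n : ℕ} {A : Set} (f : Fin n → A) (i j : Fin n) →
  ((x y : Fin n) → toℕ i ≤ toℕ x → toℕ y ≤ toℕ j → toℕ y ≡ suc (toℕ x) → f x ≡ f y) →
  (x : Fin n) → toℕ i ≤ toℕ x → toℕ x ≤ toℕ j → f x ≡ f i
constant-on-interval {n} f i j neighbours x i≤x x≤j =
  from-distance (toℕ x ∸ toℕ i) x (sym (m+[n∸m]≡n i≤x)) x≤j
  where
  from-distance : (k : ℕ) (x : Fin n) → toℕ x ≡ toℕ i + k → toℕ x ≤ toℕ j → f x ≡ f i
  from-distance zero x x≡i _ = cong f (toℕ-injective (trans x≡i (+-identityʳ (toℕ i))))
  from-distance (suc k) x x≡i+k+1 x≤j =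
    trans (sym (neighbours x′ x i≤x′ x≤j x≡1+x′)) (from-distance k x′ x′≡i+k x′≤j)
    where
    x≡1+i+k : toℕ x ≡ suc (toℕ i + k)
    x≡1+i+k = trans x≡i+k+1 (+-suc (toℕ i) k)
    i+k<n : toℕ i + k < n
    i+k<n = <⇒≤ (subst (_< n) x≡1+i+k (toℕ<n x))
    x′ : Fin n
    x′ = fromℕ< i+k<n
    x′≡i+k : toℕ x′ ≡ toℕ i + k
    x′≡i+k = toℕ-fromℕ< i+k<n
    x≡1+x′ : toℕ x ≡ suc (toℕ x′)
    x≡1+x′ = trans x≡1+i+k (cong suc (sym x′≡i+k))
    i≤x′ : toℕ i ≤ toℕ x′
    i≤x′ = subst (toℕ i ≤_) (sym x′≡i+k) (m≤m+n (toℕ i) k)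
    x′≤j : toℕ x′ ≤ toℕ j
    x′≤j = <⇒≤ (subst (_≤ toℕ j) x≡1+x′ x≤j)

one⊕-successor : (n : ℕ) .{{_ : NonZero n}} → 1 < n →
  (x y : Fin n) → toℕ y ≡ suc (toℕ x) → one n ⊕ x ≡ y
one⊕-successor n 1<n x y y≡1+x = toℕ-injective (begin
    toℕ (one n ⊕ x)            ≡⟨ toℕ-fromℕ< (m%n<n (toℕ (one n) + toℕ x) n) ⟩
    (toℕ (one n) + toℕ x) % n  ≡⟨ cong (λ t → (t + toℕ x) % n) toℕ-one ⟩
    suc (toℕ x) % n            ≡⟨ cong (_% n) (sym y≡1+x) ⟩
    toℕ y % n                  ≡⟨ m<n⇒m%n≡m (toℕ<n y) ⟩
    toℕ y                      ∎)
  where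
  open ≡-Reasoning
  toℕ-one : toℕ (one n) ≡ 1
  toℕ-one = trans (toℕ-fromℕ< (m%n<n 1 n)) (m<n⇒m%n≡m 1<n)

-- In a rainbow-free colouring, neighbours x, x+1 that both avoid the colour
-- c(1) have the same colour, since (1, x, x+1) is a Schur triple.
neighbours-same-colour : {n r : ℕ} .{{_ : NonZero n}} (c : Fin n → Fin r) →
  RainbowFree c → 1 < n → (x y : Fin n) → toℕ y ≡ suc (toℕ x) →
  c x ≢ c (one n) → c y ≢ c (one n) → c x ≡ c y
neighbours-same-colour {n} c rainbowFree 1<n x y y≡1+x cx≢R cy≢R with c x ≟ᶠ c y
... | yes cx≡cy = cx≡cy
... | no cx≢cy = ⊥-elim (rainbowFree (one n) x y
        (one⊕-successor n 1<n x y y≡1+x , (λ e → cx≢R (sym e)) , (λ e → cy≢R (sym e)) , cx≢cy))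

occursIn? : {n r : ℕ} (c : Fin n → Fin r) (i j : Fin n) (k : Fin r) → Dec (OccursIn c i j k)
occursIn? c i j k = any? (λ x → (toℕ i ≤? toℕ x) ×-dec (toℕ x ≤? toℕ j) ×-dec (c x ≟ᶠ k))

one-dominant : {n r : ℕ} .{{_ : NonZero n}} (c : Fin n → Fin r) →
  RainbowFree c → Dominant c (c (one n))
one-dominant {n} c rainbowFree i j i<j (a , b , a≢b , (xa , ia , aj , ca) , (xb , ib , bj , cb) , _)
  with occursIn? c i j (c (one n))
... | yes R-occurs = R-occurs
... | no R-absent = ⊥-elim (a≢b (begin
    a     ≡⟨ sym ca ⟩
    c xa  ≡⟨ monochromatic xa ia aj ⟩
    c i   ≡⟨ sym (monochromatic xb ib bj) ⟩
    c xb  ≡⟨ cb ⟩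
    b     ∎))
  where
  open ≡-Reasoning
  1<n : 1 < n
  1<n = ≤-trans (s≤s (s≤s z≤n)) (≤-trans (s≤s i<j) (toℕ<n j))
  avoids-R : (x : Fin n) → toℕ i ≤ toℕ x → toℕ x ≤ toℕ j → c x ≢ c (one n)
  avoids-R x i≤x x≤j cx≡R = R-absent (x , i≤x , x≤j , cx≡R)
  monochromatic : (x : Fin n) → toℕ i ≤ toℕ x → toℕ x ≤ toℕ j → c x ≡ c i
  monochromatic = constant-on-interval c i j λ x y i≤x y≤j y≡1+x →
    neighbours-same-colour c rainbowFree 1<n x y y≡1+x
      (avoids-R x i≤x (<⇒≤ (subst (_≤ toℕ j) y≡1+x y≤j)))
      (avoids-R y (≤-trans i≤x (subst (toℕ x ≤_) (sym y≡1+x) (n≤1+n (toℕ x)))) y≤j)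

lemma1 : (n : ℕ) → .{{_ : NonZero n}} → (r : ℕ) → (c : Fin n → Fin r) →
    Surjective c → RainbowFree c →
    Dominant c (c (one n)) × (∃ λ (R : Fin r) → Dominant c R)
lemma1 n r c _ rainbowFree = dominant , (c (one n) , dominant)
  where
  dominant : Dominant c (c (one n))
  dominant = one-dominant c rainbowFree
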